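{- Let $\varphi$ be an LTL formula over $V$ with decomposition $\langle\varphi_1,\dots,\varphi_n\rangle$ and let $\mathcal{S}=\langle s_1,\dots,s_n\rangle$ be strategies for the system processes. (1) Let $\Psi$ be a vector of LTL certificates. If $(\mathcal{S},\Psi)_{\mathcal{R}}$ is a solution of certifying synthesis with relevant processes for $\varphi$, then $s_1\parallel\cdots\parallel s_n\models\varphi$. (2) Let $\mathcal{G}$ be a vector of guarantee transition systems. If $(\mathcal{S},\mathcal{G})_{\mathcal{R}}$ is a solution of certifying synthesis with relevant processes for $\varphi$, then $s_1\parallel\cdots\parallel s_n\models\varphi$.
   Context: An architecture consists of an environment process $env$ with output variables $O_{env}$ and $n\ge 2$ system processes $p_1,\dots,p_n$, a finite set $V$ of variables, and for each $p_i$ an input set $I_i\subseteq V$ and output set $O_i\subseteq V$ with $I_i\cap O_i=\emptyset$ and $O_j\cap O_k=\emptyset$ for $j\ne k$. Let $V_i=I_i\cup O_i$, $V=\bigcup_i V_i$, $inp=\bigcup_i I_i$, $out=\bigcup_i O_i$. Intersections/unions of words are letterwise; $\sigma_{[t]}$ is the length-$t$ prefix, $\sigma_k$ the $k$-th letter. A (Moore) transition system over inputs $I$ and outputs $O$ is $(T,t_0,\tau,o)$ with finite $T$, $\tau:T\times 2^I\to T$, $o:T\to 2^O$; on $\gamma\in(2^I)^\omega$ it visits $t_0t_1\dots$ with $t_{k+1}=\tau(t_k,\gamma_k)$ and produces the trace $(\gamma_0\cup o(t_0))(\gamma_1\cup o(t_1))\dots$. A strategy $s_i$ is a transition system over $I_i,O_i$;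 $comp(s_i,\gamma)$ is its trace; $s_i\models\chi$ means $comp(s_i,\gamma)\cup\gamma'\models\chi$ for all $\gamma\in(2^{I_i})^\omega,\gamma'\in(2^{V\setminus V_i})^\omega$. The computation of $s_1\parallel\cdots\parallel s_n$ on $\gamma\in(2^{O_{env}})^\omega$ is the unique $\sigma\in(2^V)^\omega$ with $\sigma\cap O_{env}=\gamma$ and $\sigma\cap O_i=comp(s_i,\sigma\cap I_i)\cap O_i$ for all $i$; $s_1\parallel\cdots\parallel s_n\models\varphi$ means this satisfies $\varphi$ for all $\gamma$. Decomposition: $\varphi=\xi_1\wedge\dots\wedge\xi_k$ with atomic propositions in $V$; $\varphi_i$ is the conjunction of the $\xi_j$ whose atomic propositions intersect $O_i$ or are disjoint from $out$. Relevant processes: $\mathcal{R}_i=\{p_j\mid j\ne i,\ O_j\cap\mathrm{prop}(\varphi_i)\ne\emptyset\}$, where $\mathrm{prop}(\varphi_i)$ is the set of atomic propositions of $\varphi_i$. LTL certificates $\Psi=\langle\psi_1,\dots,\psi_n\rangle$ (LTL over $V$): $(\mathcal{S},\Psi)_{\mathcal{R}}$ is a solution if for all $i$, $s_i\models\psi_i\wedge(\Psi^{\mathcal{R}}_i\to\varphi_i)$, $\Psi^{\mathcal{R}}_i=\bigwedge_{p_j\in\mathcal{R}_i}\psi_j$. GTS: $O^G_i=O_i\cap inp$; a GTS $g_i$ is a transition system over $I_i$ and $O^G_i$. For a set $\mathcal{G}'$ of GTS, $\sigma\in(2^V)^*$ of length $t$ is a valid history w.r.t. $\mathcal{G}'$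 if for all $g_j\in\mathcal{G}'$, $1\le k\le t$ and infinite extensions $\hat\sigma$: $\sigma_k\cap O^G_j=comp(g_j,\hat\sigma\cap I_j)_k\cap O^G_j$. $s_i\models_{\mathcal{G}'}\chi$ means $comp(s_i,\gamma)\cup\gamma'\models\chi$ for all $\gamma,\gamma'$ with $comp(s_i,\gamma)_{[t]}\cup\gamma'_{[t]}$ a valid history w.r.t. $\mathcal{G}'$ for all $t$. $s_i\preceq_{O^G_i}g_i$: a relation between states of $s_i$ and $g_i$ containing the initial pair, with outputs of related states agreeing on $O^G_i$, closed under successors for every input. $(\mathcal{S},\mathcal{G})_{\mathcal{R}}$ is a solution if for all $i$: $s_i\preceq_{O^G_i}g_i$ and $s_i\models_{\mathcal{G}^{\mathcal{R}}_i}\varphi_i$, $\mathcal{G}^{\mathcal{R}}_i=\{g_j\mid p_j\in\mathcal{R}_i\}$. -}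

module Defs where

open import Data.Nat using (ℕ; zero; suc; _≤_; _<_)
open import Data.Bool using (Bool; true; false; not; _∨_; if_then_else_; T)
open import Data.Fin using (Fin)
open import Data.Fin.Subset using (Subset; _∈_; _⊆_; _∩_; _∪_; ∁; ⊥; ⋃; ⁅_⁆)
open import Data.Unit using (⊤)
open import Data.Bool using (_∧_)
open import Data.Fin using (_≟_)
open import Relation.Nullary.Decidable using (⌊_⌋)
open import Level using (Level)
open import Data.List using (List; []; _∷_; map; allFin)
open import Data.Vec using ([]; _∷_)
open import Data.Product using (Σ; ∃; _×_; _,_)
open import Data.Sum using (_⊎_)
open import Relation.Binary.PropositionalEquality using (_≡_; _≢_)
open import Relation.Nullary using (¬_)

-- Letters and words.  The variables V are Fin m; a letter is a subset of V.

Letter : ℕ → Set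
Letter m = Subset m

Word : ℕ → Set
Word m = ℕ → Letter m

WordOver : ∀ {m} → Subset m → Word m → Set
WordOver X γ = ∀ t → γ t ⊆ X

_∪ʷ_ : ∀ {m} → Word m → Word m → Word m
(γ ∪ʷ γ') t = γ t ∪ γ' t

_∩ʷ_ : ∀ {m} → Word m → Subset m → Word m
(γ ∩ʷ X) t = γ t ∩ X

isEmpty : ∀ {m} → Subset m → Bool
isEmpty [] = true
isEmpty (true ∷ p) = false
isEmpty (false ∷ p) = isEmpty p

filterᵇ : ∀ {a} {A : Set a} → (A → Bool) → List A → List A
filterᵇ f [] = []
filterᵇ f (x ∷ xs) = if f x then x ∷ filterᵇ f xs else filterᵇ f xs

data LTL (m : ℕ) : Set where
  tt   : LTL m
  atom : Fin m → LTL m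
  ¬ₗ_  : LTL m → LTL m
  _∧ₗ_ : LTL m → LTL m → LTL m
  _∨ₗ_ : LTL m → LTL m → LTL m
  _⇒ₗ_ : LTL m → LTL m → LTL m
  X_   : LTL m → LTL m
  _U_  : LTL m → LTL m → LTL m

_⟨_⟩⊨_ : ∀ {m} → Word m → ℕ → LTL m → Set
σ ⟨ i ⟩⊨ tt = ⊤
σ ⟨ i ⟩⊨ atom v = v ∈ σ i
σ ⟨ i ⟩⊨ (¬ₗ φ) = ¬ (σ ⟨ i ⟩⊨ φ)
σ ⟨ i ⟩⊨ (φ ∧ₗ ψ) = (σ ⟨ i ⟩⊨ φ) × (σ ⟨ i ⟩⊨ ψ)
σ ⟨ i ⟩⊨ (φ ∨ₗ ψ) = (σ ⟨ i ⟩⊨ φ) ⊎ (σ ⟨ i ⟩⊨ ψ)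
σ ⟨ i ⟩⊨ (φ ⇒ₗ ψ) = (σ ⟨ i ⟩⊨ φ) → (σ ⟨ i ⟩⊨ ψ)
σ ⟨ i ⟩⊨ (X φ) = σ ⟨ suc i ⟩⊨ φ
σ ⟨ i ⟩⊨ (φ U ψ) = ∃ λ k → (i ≤ k) × (σ ⟨ k ⟩⊨ ψ) × (∀ j → i ≤ j → j < k → σ ⟨ j ⟩⊨ φ)

_⊨_ : ∀ {m} → Word m → LTL m → Set
σ ⊨ φ = σ ⟨ 0 ⟩⊨ φ

prop : ∀ {m} → LTL m → Subset m
prop tt = ⊥
prop (atom v) = ⁅ v ⁆
prop (¬ₗ φ) = prop φ
prop (φ ∧ₗ ψ) = prop φ ∪ prop ψ
prop (φ ∨ₗ ψ) = prop φ ∪ prop ψ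
prop (φ ⇒ₗ ψ) = prop φ ∪ prop ψ
prop (X φ) = prop φ
prop (φ U ψ) = prop φ ∪ prop ψ

conj : ∀ {m} → List (LTL m) → LTL m
conj [] = tt
conj (ξ ∷ []) = ξ
conj (ξ ∷ ξs@(_ ∷ _)) = ξ ∧ₗ conj ξs

record Arch (m n : ℕ) : Set where
  field
    two≤n   : 2 ≤ n
    Oenv    : Subset m
    I O     : Fin n → Subset m
    IO-disj : ∀ i → I i ∩ O i ≡ ⊥
    O-disj  : ∀ j k → j ≢ k → O j ∩ O k ≡ ⊥
    Oenv-disj : ∀ i → Oenv ∩ O i ≡ ⊥
    V-cover : ∀ v → ∃ λ i → v ∈ (I i ∪ O i)
    -- every variable is output of env or of some system process
    -- (needed for the computation of the composition to be unique)
    O-cover : ∀ v → v ∈ Oenv ⊎ ∃ λ i → v ∈ O i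

  Vᵢ : Fin n → Subset m
  Vᵢ i = I i ∪ O i

  inp : Subset m
  inp = ⋃ (map I (allFin n))

  out : Subset m
  out = ⋃ (map O (allFin n))

  OG : Fin n → Subset m
  OG i = O i ∩ inp

-- Moore transition systems over inputs I and outputs O (finite state set Fin k).
-- τ is only ever applied to inputs ⊆ I; o must produce subsets of O.

record TS {m : ℕ} (I O : Subset m) : Set where
  field
    k   : ℕ
    t₀  : Fin k
    τ   : Fin k → Letter m → Fin k
    o   : Fin k → Letter m
    o⊆O : ∀ t → o t ⊆ O

  run : Word m → ℕ → Fin k
  run γ zero = t₀
  run γ (suc t) = τ (run γ t) (γ t)

  comp : Word m → Word m
  comp γ t = γ t ∪ o (run γ t)

open TS public

module _ {m n : ℕ} (A : Arch m n) where
  open Arch A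

  Strategies : Set
  Strategies = (i : Fin n) → TS (I i) (O i)

  GTSs : Set
  GTSs = (i : Fin n) → TS (I i) (OG i)

  Sat : (i : Fin n) {Oi : Subset m} → TS (I i) Oi → LTL m → Set
  Sat i s χ = ∀ γ γ' → WordOver (I i) γ → WordOver (∁ (Vᵢ i)) γ' →
              (comp s γ ∪ʷ γ') ⊨ χ

  IsComputation : Strategies → Word m → Word m → Set
  IsComputation S γ σ =
    (∀ t → σ t ∩ Oenv ≡ γ t) ×
    (∀ i t → σ t ∩ O i ≡ comp (S i) (σ ∩ʷ I i) t ∩ O i)

  ParSat : Strategies → LTL m → Set
  ParSat S φ = ∀ γ → WordOver Oenv γ → ∀ σ → IsComputation S γ σ → σ ⊨ φ

  φ_ : List (LTL m) → Fin n → LTL m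
  φ_ ξs i = conj (filterᵇ (λ ξ → not (isEmpty (prop ξ ∩ O i)) ∨ isEmpty (prop ξ ∩ out)) ξs)

  relevantᵇ : List (LTL m) → Fin n → Fin n → Bool
  relevantᵇ ξs i j = not ⌊ j ≟ i ⌋ ∧ not (isEmpty (O j ∩ prop (φ_ ξs i)))

  Relevant : List (LTL m) → Fin n → Fin n → Set
  Relevant ξs i j = T (relevantᵇ ξs i j)

  ΨR : List (LTL m) → (Fin n → LTL m) → Fin n → LTL m
  ΨR ξs Ψ i = conj (map Ψ (filterᵇ (relevantᵇ ξs i) (allFin n)))

  LTLSolution : List (LTL m) → Strategies → (Fin n → LTL m) → Set
  LTLSolution ξs S Ψ = ∀ i → Sat i (S i) (Ψ i ∧ₗ (ΨR ξs Ψ i ⇒ₗ φ_ ξs i))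

  ValidHistory : GTSs → (Fin n → Set) → Word m → ℕ → Set
  ValidHistory G P w t =
    ∀ j → P j → ∀ k → k < t → ∀ (ŵ : Word m) → (∀ k' → k' < t → ŵ k' ≡ w k') →
    w k ∩ OG j ≡ comp (G j) (ŵ ∩ʷ I j) k ∩ OG j

  SatG : (i : Fin n) → GTSs → (Fin n → Set) → TS (I i) (O i) → LTL m → Set
  SatG i G P s χ = ∀ γ γ' → WordOver (I i) γ → WordOver (∁ (Vᵢ i)) γ' →
                   (∀ t → ValidHistory G P (comp s γ ∪ʷ γ') t) →
                   (comp s γ ∪ʷ γ') ⊨ χ

  Simulated : (i : Fin n) → TS (I i) (O i) → TS (I i) (OG i) → Set₁
  Simulated i s g =
    Σ (Fin (k s) → Fin (k g) → Set) λ R →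
      R (t₀ s) (t₀ g) ×
      (∀ a b → R a b → o s a ∩ OG i ≡ o g b ∩ OG i) ×
      (∀ a b (x : Letter m) → x ⊆ I i → R a b → R (τ s a x) (τ g b x))

  GTSSolution : List (LTL m) → Strategies → GTSs → Set₁
  GTSSolution ξs S G = ∀ i → Simulated i (S i) (G i) × SatG i G (Relevant ξs i) (S i) (φ_ ξs i)

{-# OPTIONS --safe #-}
module Submission where

-- Fix a computation σ of s₁ ∥ ⋯ ∥ sₙ. Process i's own trace on σ ∩ Iᵢ, completed by σ
-- outside Vᵢ, is σ itself, so every property sᵢ guarantees for all such words holds of σ.
-- (1) Hence σ satisfies every certificate ψⱼ, which discharges the assumption Ψᴿᵢ of each
-- local specification. (2) Because sⱼ is simulated by gⱼ on the shared outputs Oᴳⱼ, every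
-- prefix of σ is a valid history w.r.t. all guarantee transition systems, so again each φᵢ
-- holds of σ. Finally every conjunct of φ occurs in some φᵢ: in φᵢ for a process i that
-- owns one of its propositions, and in every φᵢ if it mentions no system output.

open import Defs
open import Data.Nat using (zero; suc; _<_; s≤s; z≤n)
open import Data.Nat.Properties using (≤-refl; ≤-trans; <-trans; m<n⇒m<1+n)
open import Data.Fin using (Fin; fromℕ<)
open import Data.List using (List; []; _∷_; map; allFin)
open import Data.List.Relation.Unary.Any using (here; there)
open import Data.List.Relation.Unary.All as All using (All)
open import Data.List.Relation.Unary.All.Properties using (map⁺)
open import Data.List.Membership.Propositional using () renaming (_∈_ to _∈ₗ_)
open import Data.Product using (_×_; _,_; proj₁; proj₂; ∃)
open import Data.Sum using (inj₁; inj₂)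
open import Data.Bool using (Bool; true; false; not; _∨_; T)
open import Data.Bool.Properties using (T-∨)
open import Data.Unit using (tt)
open import Data.Empty using (⊥-elim)
open import Data.Vec using ([]; _∷_; here; there)
open import Data.Fin.Subset using (Subset; Nonempty; _∈_; _⊆_; _∩_; _∪_; ∁; ⋃; ⊤)
  renaming (⊥ to ∅)
open import Data.Fin.Subset.Properties
  using (∉⊥; ⊆-antisym; Empty-unique; x∈p∩q⁺; x∈p∩q⁻; x∈p∪q⁻; p∩q⊆p; p∩q⊆q; p∪∁p≡⊤;
         ∩-assoc; ∩-identityʳ; ∩-distribˡ-∪; ∩-distribʳ-∪; ∪-identityˡ)
open import Function.Base using (id)
open import Function.Bundles using (Equivalence)
open import Relation.Binary.PropositionalEquality
  using (_≡_; _≗_; refl; sym; trans; cong; cong₂; subst; module ≡-Reasoning)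

open ≡-Reasoning

⊨-resp-≗ : ∀ {m} {w w' : Word m} → w ≗ w' → ∀ {i} φ → w ⟨ i ⟩⊨ φ → w' ⟨ i ⟩⊨ φ
⊨-resp-≗ w≗w' tt _ = tt
⊨-resp-≗ w≗w' {i} (atom v) v∈ = subst (v ∈_) (w≗w' i) v∈
⊨-resp-≗ w≗w' (¬ₗ φ) ¬φ φ' = ¬φ (⊨-resp-≗ (λ t → sym (w≗w' t)) φ φ')
⊨-resp-≗ w≗w' (φ ∧ₗ ψ) (φ' , ψ') = ⊨-resp-≗ w≗w' φ φ' , ⊨-resp-≗ w≗w' ψ ψ'
⊨-resp-≗ w≗w' (φ ∨ₗ ψ) (inj₁ φ') = inj₁ (⊨-resp-≗ w≗w' φ φ')
⊨-resp-≗ w≗w' (φ ∨ₗ ψ) (inj₂ ψ') = inj₂ (⊨-resp-≗ w≗w' ψ ψ')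
⊨-resp-≗ w≗w' (φ ⇒ₗ ψ) φ⇒ψ φ' = ⊨-resp-≗ w≗w' ψ (φ⇒ψ (⊨-resp-≗ (λ t → sym (w≗w' t)) φ φ'))
⊨-resp-≗ w≗w' (X φ) φ' = ⊨-resp-≗ w≗w' φ φ'
⊨-resp-≗ w≗w' (φ U ψ) (k , i≤k , ψ' , φ') =
  k , i≤k , ⊨-resp-≗ w≗w' ψ ψ' , λ j i≤j j<k → ⊨-resp-≗ w≗w' φ (φ' j i≤j j<k)

⊨-conj⁺ : ∀ {m} {w : Word m} (ξs : List (LTL m)) → All (w ⊨_) ξs → w ⊨ conj ξs
⊨-conj⁺ []               All.[]             = tt
⊨-conj⁺ (ξ ∷ [])         (w⊨ξ All.∷ All.[]) = w⊨ξ
⊨-conj⁺ (ξ ∷ ξs@(_ ∷ _)) (w⊨ξ All.∷ w⊨ξs)   = w⊨ξ , ⊨-conj⁺ ξs w⊨ξs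

⊨-conj⁻ : ∀ {m} {w : Word m} (ξs : List (LTL m)) → w ⊨ conj ξs → All (w ⊨_) ξs
⊨-conj⁻ []               _             = All.[]
⊨-conj⁻ (ξ ∷ [])         w⊨ξ           = w⊨ξ All.∷ All.[]
⊨-conj⁻ (ξ ∷ ξs@(_ ∷ _)) (w⊨ξ , w⊨ξs) = w⊨ξ All.∷ ⊨-conj⁻ ξs w⊨ξs

∈-filterᵇ⁺ : ∀ {a} {A : Set a} (p : A → Bool) {xs} {x} → x ∈ₗ xs → T (p x) → x ∈ₗ filterᵇ p xs
∈-filterᵇ⁺ p {y ∷ _} x∈xs px with p y in py
∈-filterᵇ⁺ p (here refl)  px | true  = here refl
∈-filterᵇ⁺ p (there x∈xs) px | true  = there (∈-filterᵇ⁺ p x∈xs px)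
∈-filterᵇ⁺ p (here refl)  px | false = ⊥-elim (subst T py px)
∈-filterᵇ⁺ p (there x∈xs) px | false = ∈-filterᵇ⁺ p x∈xs px

isEmpty≡false⇒Nonempty : ∀ {m} (p : Subset m) → isEmpty p ≡ false → Nonempty p
isEmpty≡false⇒Nonempty (true ∷ p)  _ = Fin.zero , here
isEmpty≡false⇒Nonempty (false ∷ p) e with isEmpty≡false⇒Nonempty p e
... | x , x∈p = Fin.suc x , there x∈p

x∈p⇒isEmpty≡false : ∀ {m} {p : Subset m} {x} → x ∈ p → isEmpty p ≡ false
x∈p⇒isEmpty≡false here = refl
x∈p⇒isEmpty≡false {p = true ∷ _}  (there _)   = refl
x∈p⇒isEmpty≡false {p = false ∷ _} (there x∈p) = x∈p⇒isEmpty≡false x∈p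

x∈⋃-map⁻ : ∀ {a m} {A : Set a} (f : A → Subset m) (xs : List A) {v} →
           v ∈ ⋃ (map f xs) → ∃ λ x → v ∈ f x
x∈⋃-map⁻ f []       v∈ = ⊥-elim (∉⊥ v∈)
x∈⋃-map⁻ f (x ∷ xs) v∈ with x∈p∪q⁻ (f x) (⋃ (map f xs)) v∈
... | inj₁ v∈fx = x , v∈fx
... | inj₂ v∈⋃  = x∈⋃-map⁻ f xs v∈⋃

p⊆q⇒p∩q≡p : ∀ {m} {p q : Subset m} → p ⊆ q → p ∩ q ≡ p
p⊆q⇒p∩q≡p {p = p} {q} p⊆q = ⊆-antisym (p∩q⊆p p q) (λ x∈p → x∈p∩q⁺ (x∈p , p⊆q x∈p))

disjoint-anti-mono : ∀ {m} {p q p' q' : Subset m} → p ∩ q ≡ ∅ → p' ⊆ p → q' ⊆ q → p' ∩ q' ≡ ∅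
disjoint-anti-mono {p = p} {q} {p'} {q'} p∩q≡∅ p'⊆p q'⊆q = Empty-unique λ (x , x∈p'∩q') →
  let x∈p' , x∈q' = x∈p∩q⁻ p' q' x∈p'∩q'
  in ∉⊥ (subst (x ∈_) p∩q≡∅ (x∈p∩q⁺ (p'⊆p x∈p' , q'⊆q x∈q')))

p∩q∪p∩∁q≡p : ∀ {m} (p q : Subset m) → (p ∩ q) ∪ (p ∩ ∁ q) ≡ p
p∩q∪p∩∁q≡p p q = begin
  (p ∩ q) ∪ (p ∩ ∁ q) ≡⟨ sym (∩-distribˡ-∪ p q (∁ q)) ⟩
  p ∩ (q ∪ ∁ q)       ≡⟨ cong (p ∩_) (p∪∁p≡⊤ q) ⟩
  p ∩ ⊤               ≡⟨ ∩-identityʳ p ⟩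
  p                   ∎

∩ʷ-over : ∀ {m} (w : Word m) (Y : Subset m) → WordOver Y (w ∩ʷ Y)
∩ʷ-over w Y t = p∩q⊆q (w t) Y

module _ {m} {I O : Subset m} (s : TS I O) where

  run-cong-prefix : ∀ {γ γ'} k → (∀ k' → k' < k → γ k' ≡ γ' k') → run s γ k ≡ run s γ' k
  run-cong-prefix zero    _     = refl
  run-cong-prefix (suc k) γ≡γ' =
    cong₂ (τ s) (run-cong-prefix k (λ k' k'<k → γ≡γ' k' (m<n⇒m<1+n k'<k))) (γ≡γ' k ≤-refl)

  comp-∩-output : ∀ γ t Y → γ t ∩ Y ≡ ∅ → comp s γ t ∩ Y ≡ o s (run s γ t) ∩ Y
  comp-∩-output γ t Y γₜ∩Y≡∅ = begin
    (γ t ∪ o s (run s γ t)) ∩ Y            ≡⟨ ∩-distribʳ-∪ Y (γ t) (o s (run s γ t)) ⟩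
    (γ t ∩ Y) ∪ (o s (run s γ t) ∩ Y)      ≡⟨ cong (_∪ (o s (run s γ t) ∩ Y)) γₜ∩Y≡∅ ⟩
    ∅ ∪ (o s (run s γ t) ∩ Y)              ≡⟨ ∪-identityˡ _ ⟩
    o s (run s γ t) ∩ Y                    ∎

module _ {m n} (A : Arch m n) where
  open Arch A

  conjunctOfᵇ : Fin n → LTL m → Bool
  conjunctOfᵇ i ξ = not (isEmpty (prop ξ ∩ O i)) ∨ isEmpty (prop ξ ∩ out)

  some-process : Fin n
  some-process = fromℕ< (≤-trans (s≤s z≤n) two≤n)

  owner-of-output : (p : Subset m) → Nonempty (p ∩ out) → ∃ λ i → Nonempty (p ∩ O i)
  owner-of-output p (v , v∈p∩out) =
    let v∈p , v∈out = x∈p∩q⁻ p out v∈p∩out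
        i , v∈Oᵢ    = x∈⋃-map⁻ O (allFin n) v∈out
    in i , v , x∈p∩q⁺ (v∈p , v∈Oᵢ)

  -- A conjunct mentioning no system output belongs to every φᵢ; this needs n ≥ 1.
  conjunct-of-some-process : ∀ ξ → ∃ λ i → T (conjunctOfᵇ i ξ)
  conjunct-of-some-process ξ with isEmpty (prop ξ ∩ out) in noOutput
  ... | true  =
    some-process , Equivalence.from (T-∨ {not (isEmpty (prop ξ ∩ O some-process))}) (inj₂ tt)
  ... | false with owner-of-output (prop ξ) (isEmpty≡false⇒Nonempty _ noOutput)
  ...   | i , _ , v∈ξ∩Oᵢ =
    i , Equivalence.from (T-∨ {y = false})
          (inj₁ (subst (λ b → T (not b)) (sym (x∈p⇒isEmpty≡false v∈ξ∩Oᵢ)) tt))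

  ⊨-decomposition : ∀ {w} ξs → (∀ i → w ⊨ φ_ A ξs i) → w ⊨ conj ξs
  ⊨-decomposition ξs w⊨φᵢ = ⊨-conj⁺ ξs (All.tabulate λ {ξ} ξ∈ξs →
    let i , ξ∈φᵢ = conjunct-of-some-process ξ
    in All.lookup (⊨-conj⁻ _ (w⊨φᵢ i)) (∈-filterᵇ⁺ (conjunctOfᵇ i) ξ∈ξs ξ∈φᵢ))

  input∩output≡∅ : ∀ i {p q} → p ⊆ I i → q ⊆ O i → p ∩ q ≡ ∅
  input∩output≡∅ i = disjoint-anti-mono (IO-disj i)

  simulated-outputs : ∀ {i s g} → Simulated A i s g → ∀ {γ} → WordOver (I i) γ → ∀ k →
                      o s (run s γ k) ∩ OG i ≡ o g (run g γ k) ∩ OG i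
  simulated-outputs {s = s} {g} (R , R₀ , R-o , R-τ) {γ} γ⊆I k = R-o _ _ (related k)
    where
    related : ∀ k → R (run s γ k) (run g γ k)
    related zero    = R₀
    related (suc k) = R-τ _ _ (γ k) (γ⊆I k) (related k)

  ValidHistory-resp-≗ : ∀ G {P w w'} → w ≗ w' → ∀ {t} → ValidHistory A G P w t → ValidHistory A G P w' t
  ValidHistory-resp-≗ G w≗w' valid j Pj k k<t ŵ ŵ≡w' =
    trans (cong (_∩ OG j) (sym (w≗w' k)))
          (valid j Pj k k<t ŵ (λ k' k'<t → trans (ŵ≡w' k' k'<t) (sym (w≗w' k'))))

  module Computation (S : Strategies A) {σ : Word m}
                     (local : ∀ i t → σ t ∩ O i ≡ comp (S i) (σ ∩ʷ I i) t ∩ O i) where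

    output-letter : ∀ i t → σ t ∩ O i ≡ o (S i) (run (S i) (σ ∩ʷ I i) t)
    output-letter i t = begin
      σ t ∩ O i                                 ≡⟨ local i t ⟩
      comp (S i) (σ ∩ʷ I i) t ∩ O i             ≡⟨ comp-∩-output (S i) _ t (O i) (input∩output≡∅ i (p∩q⊆q _ _) id) ⟩
      o (S i) (run (S i) (σ ∩ʷ I i) t) ∩ O i    ≡⟨ p⊆q⇒p∩q≡p (o⊆O (S i) _) ⟩
      o (S i) (run (S i) (σ ∩ʷ I i) t)          ∎

    shared-output-letter : ∀ i t → σ t ∩ OG i ≡ o (S i) (run (S i) (σ ∩ʷ I i) t) ∩ OG i
    shared-output-letter i t = begin
      σ t ∩ (O i ∩ inp)       ≡⟨ sym (∩-assoc (σ t) (O i) inp) ⟩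
      (σ t ∩ O i) ∩ inp       ≡⟨ cong (_∩ inp) (output-letter i t) ⟩
      oᵢ ∩ inp                ≡⟨ cong (_∩ inp) (sym (p⊆q⇒p∩q≡p (o⊆O (S i) _))) ⟩
      (oᵢ ∩ O i) ∩ inp        ≡⟨ ∩-assoc oᵢ (O i) inp ⟩
      oᵢ ∩ (O i ∩ inp)        ∎
      where oᵢ = o (S i) (run (S i) (σ ∩ʷ I i) t)

    trace≡σ∩Vᵢ : ∀ i t → comp (S i) (σ ∩ʷ I i) t ≡ σ t ∩ Vᵢ i
    trace≡σ∩Vᵢ i t = begin
      (σ t ∩ I i) ∪ o (S i) (run (S i) (σ ∩ʷ I i) t) ≡⟨ cong ((σ t ∩ I i) ∪_) (sym (output-letter i t)) ⟩
      (σ t ∩ I i) ∪ (σ t ∩ O i)                      ≡⟨ sym (∩-distribˡ-∪ (σ t) (I i) (O i)) ⟩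
      σ t ∩ Vᵢ i                                     ∎

    localView : Fin n → Word m
    localView i = comp (S i) (σ ∩ʷ I i) ∪ʷ (σ ∩ʷ ∁ (Vᵢ i))

    localView≗σ : ∀ i → localView i ≗ σ
    localView≗σ i t = trans (cong (_∪ (σ t ∩ ∁ (Vᵢ i))) (trace≡σ∩Vᵢ i t)) (p∩q∪p∩∁q≡p (σ t) (Vᵢ i))

    Sat⇒⊨ : ∀ {i} χ → Sat A i (S i) χ → σ ⊨ χ
    Sat⇒⊨ {i} χ sat = ⊨-resp-≗ (localView≗σ i) χ (sat _ _ (∩ʷ-over σ (I i)) (∩ʷ-over σ (∁ (Vᵢ i))))

    SatG⇒⊨ : ∀ {i} G {P} χ → SatG A i G P (S i) χ → (∀ t → ValidHistory A G P σ t) → σ ⊨ χ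
    SatG⇒⊨ {i} G χ sat valid =
      ⊨-resp-≗ (localView≗σ i) χ
        (sat _ _ (∩ʷ-over σ (I i)) (∩ʷ-over σ (∁ (Vᵢ i)))
             (λ t → ValidHistory-resp-≗ G (λ t' → sym (localView≗σ i t')) (valid t)))

    -- Valid histories quantify over all extensions ŵ; these do not matter because the
    -- output of a Moore machine at step k depends only on its inputs before k.
    σ-valid-history : ∀ G → (∀ j → Simulated A j (S j) (G j)) → ∀ {P} t → ValidHistory A G P σ t
    σ-valid-history G sim t j _ k k<t ŵ ŵ≡σ = begin
      σ k ∩ OG j                                ≡⟨ shared-output-letter j k ⟩
      o (S j) (run (S j) (σ ∩ʷ I j) k) ∩ OG j   ≡⟨ simulated-outputs (sim j) (∩ʷ-over σ (I j)) k ⟩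
      o (G j) (run (G j) (σ ∩ʷ I j) k) ∩ OG j   ≡⟨ cong (λ q → o (G j) q ∩ OG j) (run-cong-prefix (G j) k σ≡ŵ) ⟩
      o (G j) (run (G j) (ŵ ∩ʷ I j) k) ∩ OG j   ≡⟨ sym (comp-∩-output (G j) _ k (OG j) ŵₖ∩Iⱼ∩OGⱼ≡∅) ⟩
      comp (G j) (ŵ ∩ʷ I j) k ∩ OG j            ∎
      where
      σ≡ŵ : ∀ k' → k' < k → σ k' ∩ I j ≡ ŵ k' ∩ I j
      σ≡ŵ k' k'<k = cong (_∩ I j) (sym (ŵ≡σ k' (<-trans k'<k k<t)))
      ŵₖ∩Iⱼ∩OGⱼ≡∅ : (ŵ k ∩ I j) ∩ OG j ≡ ∅
      ŵₖ∩Iⱼ∩OGⱼ≡∅ = input∩output≡∅ j (p∩q⊆q _ _) (p∩q⊆p _ _)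

    certificates-sound : ∀ ξs Ψ → LTLSolution A ξs S Ψ → σ ⊨ conj ξs
    certificates-sound ξs Ψ sol = ⊨-decomposition ξs λ i → proj₂ (local-spec i) (assumption i)
      where
      local-spec : ∀ i → σ ⊨ (Ψ i ∧ₗ (ΨR A ξs Ψ i ⇒ₗ φ_ A ξs i))
      local-spec i = Sat⇒⊨ (Ψ i ∧ₗ (ΨR A ξs Ψ i ⇒ₗ φ_ A ξs i)) (sol i)
      assumption : ∀ i → σ ⊨ ΨR A ξs Ψ i
      assumption i = ⊨-conj⁺ (map Ψ relevant) (map⁺ (All.universal (λ j → proj₁ (local-spec j)) relevant))
        where relevant = filterᵇ (relevantᵇ A ξs i) (allFin n)

    guarantees-sound : ∀ ξs G → GTSSolution A ξs S G → σ ⊨ conj ξs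
    guarantees-sound ξs G sol = ⊨-decomposition ξs λ i →
      SatG⇒⊨ G (φ_ A ξs i) (proj₂ (sol i)) (σ-valid-history G (λ j → proj₁ (sol j)))

lemma5 : ∀ {m n} (A : Arch m n) (ξs : List (LTL m)) (S : Strategies A) →
         (∀ (Ψ : Fin n → LTL m) → LTLSolution A ξs S Ψ → ParSat A S (conj ξs)) ×
         (∀ (G : GTSs A) → GTSSolution A ξs S G → ParSat A S (conj ξs))
lemma5 A ξs S =
  (λ Ψ sol _ _ σ (_ , local) → Computation.certificates-sound A S local ξs Ψ sol) ,
  (λ G sol _ _ σ (_ , local) → Computation.guarantees-sound A S local ξs G sol)
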